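{- Let $\mathbb{K}$ be a field of characteristic $0$ and $(\lambda,\mu),(\vartheta,\omega)\in\mathrm{BP}_n$ with $V_{(\lambda,\mu)}\subset V_{(\vartheta,\omega)}$. Then $(\vartheta,\omega)\unlhd(\lambda,\mu)$.
   Context: A partition is a non-increasing sequence of non-negative integers (zero beyond its length); $\mathrm{BP}_n$ is the set of pairs of partitions with total size $n$. Bidominance: $(\vartheta,\omega)\unlhd(\lambda,\mu)$ iff for all $k\ge1$, $\sum_{j\le k}(\vartheta_j+\omega_j)\le\sum_{j\le k}(\lambda_j+\mu_j)$ and $\sum_{j\le k-1}(\vartheta_j+\omega_j)+\vartheta_k\le\sum_{j\le k-1}(\lambda_j+\mu_j)+\lambda_k$. A bitableau of shape $(\lambda,\mu)$ fills the pair of Young diagrams with $1,\dots,n$ each once; with $\Delta_{(i_1,\dots,i_m)}(\mathbf{y})=\prod_{j<k}(y_{i_j}-y_{i_k})$, its Specht polynomial is $\mathrm{sp}_{(T,S)}(\mathbf{x})=\prod_i\Delta_{T_i}(\mathbf{x}^2)\prod_j\Delta_{S_j}(\mathbf{x}^2)\prod_{k\in S}x_k$ ($T_i,S_j$ columns, $\mathbf{x}^2=(x_1^2,\dots,x_n^2)$). $V_{(\lambda,\mu)}\subset\mathbb{K}^n$ is the common zero set of all Specht polynomials of bitableaux of shape $(\lambda,\mu)$. -}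

module Defs where

open import Level using (Level; _⊔_)
open import Algebra.Bundles using (CommutativeRing; Semiring)
import Algebra.Definitions.RawSemiring as RSDefs
open import Data.Nat as ℕ using (ℕ; zero; suc)
open import Data.Nat.ListAction using (sum)
open import Data.Fin using (Fin)
open import Data.List using (List; []; _∷_; length; map; foldr; concat; upTo; _++_; mapMaybe; allFin)
open import Data.Maybe using (Maybe; just; nothing)
open import Data.List.Relation.Unary.Linked using (Linked)
open import Data.List.Relation.Binary.Permutation.Propositional using (_↭_)
open import Data.Product using (Σ; _×_; ∃-syntax)
open import Relation.Nullary using (¬_)
open import Relation.Binary.PropositionalEquality using (_≡_)

private
  variable
    c ℓ : Level

record IsField (R : CommutativeRing c ℓ) : Set (c ⊔ ℓ) where
  open CommutativeRing R
  field
    1≉0     : ¬ (1# ≈ 0#)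
    inverse : ∀ x → ¬ (x ≈ 0#) → ∃[ y ] (x * y ≈ 1#)

CharZero : (R : CommutativeRing c ℓ) → Set ℓ
CharZero R = ∀ (m : ℕ) → ¬ ((suc m ·1 1#) ≈ 0#)
  where open CommutativeRing R using (1#; 0#; _≈_; semiring)
        open RSDefs (Semiring.rawSemiring semiring) using () renaming (_×_ to _·1_)

IsPartition : List ℕ → Set
IsPartition = Linked ℕ._≥_

-- part j, 0-based (λ_{j+1} in the paper's 1-based notation)
part : List ℕ → ℕ → ℕ
part []       _       = 0
part (a ∷ _)  zero    = a
part (_ ∷ as) (suc j) = part as j

InBP : ℕ → List ℕ → List ℕ → Set
InBP n λ' μ = IsPartition λ' × IsPartition μ × sum λ' ℕ.+ sum μ ≡ n

sumBelow : ℕ → (ℕ → ℕ) → ℕ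
sumBelow zero    f = 0
sumBelow (suc k) f = sumBelow k f ℕ.+ f k

-- Bidominance (ϑ,ω) ⊴ (λ,μ): for all k ≥ 1 (here k = suc i),
--   Σ_{j≤k}(ϑ_j+ω_j) ≤ Σ_{j≤k}(λ_j+μ_j)  and
--   Σ_{j≤k-1}(ϑ_j+ω_j)+ϑ_k ≤ Σ_{j≤k-1}(λ_j+μ_j)+λ_k.
_⊴_ : (List ℕ × List ℕ) → (List ℕ × List ℕ) → Set
(ϑ Data.Product., ω) ⊴ (λ' Data.Product., μ) =
  ∀ (i : ℕ) →
    (sumBelow (suc i) (λ j → part ϑ j ℕ.+ part ω j)
       ℕ.≤ sumBelow (suc i) (λ j → part λ' j ℕ.+ part μ j))
  × (sumBelow i (λ j → part ϑ j ℕ.+ part ω j) ℕ.+ part ϑ i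
       ℕ.≤ sumBelow i (λ j → part λ' j ℕ.+ part μ j) ℕ.+ part λ' i)

-- Tableaux: a filling given as its list of rows (top to bottom),
-- each row a list of entries from left to right.

Filling : ℕ → Set
Filling n = List (List (Fin n))

shape : ∀ {n} → Filling n → List ℕ
shape = map length

entry : ∀ {A : Set} → List A → ℕ → Maybe A
entry []       _       = nothing
entry (a ∷ _)  zero    = just a
entry (_ ∷ as) (suc j) = entry as j

column : ∀ {n} → ℕ → Filling n → List (Fin n)
column j T = mapMaybe (λ r → entry r j) T

numColumns : ∀ {n} → Filling n → ℕ
numColumns = foldr (λ r m → length r ℕ.⊔ m) 0

columns : ∀ {n} → Filling n → List (List (Fin n))
columns T = map (λ j → column j T) (upTo (numColumns T))

IsBitableau : ∀ {n} → List ℕ → List ℕ → Filling n → Filling n → Set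
IsBitableau {n} λ' μ T S =
  shape T ≡ λ' × shape S ≡ μ × (concat T ++ concat S) ↭ allFin n

module _ (R : CommutativeRing c ℓ) where
  open CommutativeRing R

  prod : List Carrier → Carrier
  prod = foldr _*_ 1#

  Δ : ∀ {n} → (Fin n → Carrier) → List (Fin n) → Carrier
  Δ y []       = 1#
  Δ y (a ∷ as) = prod (map (λ b → y a - y b) as) * Δ y as

  specht : ∀ {n} → Filling n → Filling n → (Fin n → Carrier) → Carrier
  specht T S x =
    prod (map (Δ x²) (columns T)) * prod (map (Δ x²) (columns S))
      * prod (map x (concat S))
    where x² = λ k → x k * x k

  InV : (n : ℕ) → List ℕ → List ℕ → (Fin n → Carrier) → Set ℓ
  InV n λ' μ x = ∀ (T S : Filling n) → IsBitableau λ' μ T S → specht T S x ≈ 0#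

-- Each bidominance inequality has the form
--   Σ_{j<t} ϑ_j + Σ_{j<s} ω_j ≤ Σ_{j<t} λ_j + Σ_{j<s} μ_j  with  t ∈ {s, s + 1}.
-- Fill the diagrams of (ϑ, ω) with 1, …, n row by row, give the entries of row j of ϑ the colour j
-- and those of row j of ω the colour j if j < s and t + j otherwise, and let x_p = c + 1 for an
-- entry p of colour c, except x_p = 0 when s ≤ c < t.  Colours are distinct within each column and
-- no entry of ω gets the value 0, so in characteristic 0 this Specht polynomial does not vanish at x.
-- Conversely, if a Specht polynomial of shape (λ, μ) does not vanish at x, its columns carry distinct
-- colours and no entry of its second diagram has a colour in [s, t).  Then a column of λ holds at
-- most t, and a column of μ at most s, entries of colour < t, so there are at most
-- Σ_{j<t} λ_j + Σ_{j<s} μ_j such entries, whereas the canonical filling shows there are exactly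
-- Σ_{j<t} ϑ_j + Σ_{j<s} ω_j of them.  Hence if the inequality failed, x ∈ V_(λ,μ) but x ∉ V_(ϑ,ω).

module Submission where

open import Defs
open import Level using (Level)
open import Algebra.Bundles using (CommutativeRing)
open import Data.Nat using (ℕ)
open import Data.Fin using (Fin)
open import Data.List using (List)
open import Data.Product using (_,_)

import Algebra.Properties.CommutativeSemigroup as CommutativeSemigroupProperties
import Algebra.Properties.Group as GroupProperties
import Algebra.Properties.Semiring.Mult as SemiringMultiplication
open import Data.Empty using (⊥-elim)
open import Data.Fin.Properties using () renaming (_≟_ to _≟ᶠ_)
open import Data.List using ([]; _∷_; _++_; map; concat; take; drop; length; allFin)
open import Data.List.Properties
  using (map-++; map-∘; map-id; map-cong-local; length-++; length-take; length-drop; length-tabulate;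
         take-map; take++drop≡id)
open import Data.List.Relation.Binary.Permutation.Propositional using (_↭_; ↭-reflexive)
import Data.List.Relation.Binary.Permutation.Propositional.Properties as Perm
open import Data.List.Relation.Unary.All as All using (All; []; _∷_)
import Data.List.Relation.Unary.All.Properties as All
open import Data.List.Relation.Unary.AllPairs as AllPairs using (AllPairs; []; _∷_)
import Data.List.Relation.Unary.AllPairs.Properties as AllPairs
open import Data.List.Relation.Unary.Linked as Linked using (_∷_)
import Data.List.Relation.Unary.Linked.Properties as Linked
open import Data.List.Relation.Unary.Unique.Propositional.Properties using (allFin⁺)
open import Data.Maybe using (just; nothing)
import Data.Nat as ℕ
open import Data.Nat using (zero; suc; pred; _+_; _∸_; _⊓_; _≤_; _<_; z≤n; s≤s; _≟_; _<?_; _≤?_)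
open import Data.Nat.ListAction using (sum)
open import Data.Nat.ListAction.Properties using (sum-++; sum-↭)
open import Data.Nat.Properties
  using (+-commutativeSemigroup; +-comm; +-assoc; +-identityʳ; +-suc; +-cancelˡ-≡; +-mono-≤;
         *-identityʳ; *-zeroʳ; *-mono-<; ≤-refl; ≤-reflexive; ≤-trans; ≤-antisym; ≤-pred; <-≤-trans;
         <-irrefl; <-cmp; ≮⇒≥; ≰⇒>; n≤1+n; m≤m+n; m+n∸m≡n; ∸-monoˡ-≤; m≤n⇒m⊓n≡m; ⊓-zeroʳ; ⊓-glb;
         m≤m⊔n; m≤n⊔m; m≤n⇒∃[o]m+o≡n; suc-injective; 0≢1+n; module ≤-Reasoning)
open import Data.Product using (Σ-syntax; _×_; proj₁; proj₂; uncurry)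
open import Data.Sum as Sum using (_⊎_; inj₁; inj₂)
open import Data.Unit using (⊤; tt)
open import Function using (_∘_; id; _on_)
open import Function.Definitions using (Injective)
open import Relation.Binary using (tri<; tri≈; tri>)
open import Relation.Binary.PropositionalEquality
open import Relation.Nullary using (¬_; Dec; yes; no)
open import Relation.Nullary.Decidable using (_⊎-dec_)

private
  variable
    A B : Set
    n : ℕ

open CommutativeSemigroupProperties +-commutativeSemigroup using (interchange; xy∙z≈xz∙y)

count : (A → ℕ) → List A → ℕ
count f xs = sum (map f xs)

count-++ : ∀ (f : A → ℕ) xs ys → count f (xs ++ ys) ≡ count f xs + count f ys
count-++ f xs ys = trans (cong sum (map-++ f xs ys)) (sum-++ (map f xs) (map f ys))

count-↭ : ∀ (f : A → ℕ) {xs ys} → xs ↭ ys → count f xs ≡ count f ys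
count-↭ f xs↭ys = sum-↭ (Perm.map⁺ f xs↭ys)

count-cong : ∀ {f g : A → ℕ} {xs} → All (λ a → f a ≡ g a) xs → count f xs ≡ count g xs
count-cong f≡g = cong sum (map-cong-local f≡g)

count-+ : ∀ (f g : A → ℕ) xs → count (λ a → f a + g a) xs ≡ count f xs + count g xs
count-+ f g []       = refl
count-+ f g (a ∷ xs) =
  trans (cong (f a + g a +_) (count-+ f g xs)) (interchange (f a) (g a) (count f xs) (count g xs))

count-constant : ∀ {f : A → ℕ} {v} xs → All (λ a → f a ≡ v) xs → count f xs ≡ length xs ℕ.* v
count-constant []       []           = refl
count-constant (a ∷ xs) (fa≡v ∷ f≡v) = cong₂ _+_ fa≡v (count-constant xs f≡v)

count-1≡length : ∀ (xs : List A) → count (λ _ → 1) xs ≡ length xs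
count-1≡length xs = trans (count-constant xs (All.universal (λ _ → refl) xs)) (*-identityʳ (length xs))

count≤length : ∀ {f : A → ℕ} → (∀ a → f a ≤ 1) → ∀ xs → count f xs ≤ length xs
count≤length f≤1 []       = z≤n
count≤length f≤1 (a ∷ xs) = +-mono-≤ (f≤1 a) (count≤length f≤1 xs)

below : ℕ → ℕ → ℕ
below zero    _       = 0
below (suc k) zero    = 1
below (suc k) (suc a) = below k a

equalTo : ℕ → ℕ → ℕ
equalTo zero    zero    = 1
equalTo zero    (suc _) = 0
equalTo (suc k) zero    = 0
equalTo (suc k) (suc a) = equalTo k a

below≤1 : ∀ k a → below k a ≤ 1
below≤1 zero    _       = z≤n
below≤1 (suc k) zero    = s≤s z≤n
below≤1 (suc k) (suc a) = below≤1 k a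

below-< : ∀ {k a} → a < k → below k a ≡ 1
below-< {suc k} {zero}  _         = refl
below-< {suc k} {suc a} (s≤s a<k) = below-< a<k

below-≥ : ∀ {k a} → k ≤ a → below k a ≡ 0
below-≥ {zero}          _         = refl
below-≥ {suc k} {suc a} (s≤s k≤a) = below-≥ k≤a

below-pred : ∀ k a → below k (suc a) ≡ below (pred k) a
below-pred zero    a = refl
below-pred (suc k) a = refl

below-suc : ∀ k a → below (suc k) a ≡ below k a + equalTo k a
below-suc zero    zero    = refl
below-suc zero    (suc a) = refl
below-suc (suc k) zero    = refl
below-suc (suc k) (suc a) = below-suc k a

below-outside : ∀ {s t a} → s ≤ t → a < s ⊎ t ≤ a → below t a ≡ below s a
below-outside s≤t (inj₁ a<s) = trans (below-< (<-≤-trans a<s s≤t)) (sym (below-< a<s))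
below-outside s≤t (inj₂ t≤a) = trans (below-≥ t≤a) (sym (below-≥ (≤-trans s≤t t≤a)))

equalTo-self : ∀ k → equalTo k k ≡ 1
equalTo-self zero    = refl
equalTo-self (suc k) = equalTo-self k

equalTo-≢ : ∀ {k a} → a ≢ k → equalTo k a ≡ 0
equalTo-≢ {zero}  {zero}  a≢k = ⊥-elim (a≢k refl)
equalTo-≢ {zero}  {suc a} a≢k = refl
equalTo-≢ {suc k} {zero}  a≢k = refl
equalTo-≢ {suc k} {suc a} a≢k = equalTo-≢ (a≢k ∘ cong suc)

count-equalTo-distinct : ∀ k (c : A → ℕ) {xs} → AllPairs (_≢_ on c) xs → count (equalTo k ∘ c) xs ≤ 1
count-equalTo-distinct k c {[]}     []                   = z≤n
count-equalTo-distinct k c {a ∷ xs} (a-fresh ∷ distinct) with c a ≟ k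
... | no ca≢k rewrite equalTo-≢ ca≢k = count-equalTo-distinct k c distinct
... | yes refl = ≤-reflexive (begin
  equalTo (c a) (c a) + count (equalTo (c a) ∘ c) xs
    ≡⟨ cong₂ _+_ (equalTo-self (c a)) (count-constant xs (All.map (equalTo-≢ ∘ ≢-sym) a-fresh)) ⟩
  1 + length xs ℕ.* 0
    ≡⟨ cong suc (*-zeroʳ (length xs)) ⟩
  1 ∎)
  where open ≡-Reasoning

count-below-distinct : ∀ k (c : A → ℕ) {xs} → AllPairs (_≢_ on c) xs → count (below k ∘ c) xs ≤ k
count-below-distinct zero    c {xs} _ =
  ≤-reflexive (trans (count-constant xs (All.universal (λ _ → refl) xs)) (*-zeroʳ (length xs)))
count-below-distinct (suc k) c {xs} distinct = begin
  count (below (suc k) ∘ c) xs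
    ≡⟨ count-cong (All.universal (below-suc k ∘ c) xs) ⟩
  count (λ a → below k (c a) + equalTo k (c a)) xs
    ≡⟨ count-+ (below k ∘ c) (equalTo k ∘ c) xs ⟩
  count (below k ∘ c) xs + count (equalTo k ∘ c) xs
    ≤⟨ +-mono-≤ (count-below-distinct k c distinct) (count-equalTo-distinct k c distinct) ⟩
  k + 1
    ≡⟨ +-comm k 1 ⟩
  suc k
    ∎
  where open ≤-Reasoning

sumBelow-suc : ∀ k f → sumBelow (suc k) f ≡ f 0 + sumBelow k (f ∘ suc)
sumBelow-suc zero    f = +-comm 0 (f 0)
sumBelow-suc (suc k) f = trans (cong (_+ f (suc k)) (sumBelow-suc k f)) (+-assoc (f 0) _ _)

sumBelow-zero : ∀ k → sumBelow k (λ _ → 0) ≡ 0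
sumBelow-zero zero    = refl
sumBelow-zero (suc k) = trans (+-identityʳ _) (sumBelow-zero k)

sumBelow-+ : ∀ k f g → sumBelow k (λ j → f j + g j) ≡ sumBelow k f + sumBelow k g
sumBelow-+ zero    f g = refl
sumBelow-+ (suc k) f g =
  trans (cong (_+ (f k + g k)) (sumBelow-+ k f g))
        (interchange (sumBelow k f) (sumBelow k g) (f k) (g k))

sumBelow-part-∷ : ∀ k m ms →
                  m ℕ.* below k 0 + sumBelow (pred k) (part ms) ≡ sumBelow k (part (m ∷ ms))
sumBelow-part-∷ zero    m ms = trans (+-identityʳ (m ℕ.* 0)) (*-zeroʳ m)
sumBelow-part-∷ (suc k) m ms =
  trans (cong (_+ sumBelow k (part ms)) (*-identityʳ m)) (sym (sumBelow-suc k (part (m ∷ ms))))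

dropColumn : Filling n → Filling n
dropColumn = map (drop 1)

column-suc : ∀ j (T : Filling n) → column (suc j) T ≡ column j (dropColumn T)
column-suc j []            = refl
column-suc j ([] ∷ T)      = column-suc j T
column-suc j ((a ∷ r) ∷ T) with entry r j
... | just b  = cong (b ∷_) (column-suc j T)
... | nothing = column-suc j T

count-concat : ∀ (g : Fin n → ℕ) T →
               count g (concat T) ≡ count g (column 0 T) + count g (concat (dropColumn T))
count-concat g []            = refl
count-concat g ([] ∷ T)      = count-concat g T
count-concat g ((a ∷ r) ∷ T) = begin
  g a + count g (r ++ concat T)
    ≡⟨ cong (g a +_) (count-++ g r (concat T)) ⟩
  g a + (count g r + count g (concat T))
    ≡⟨ cong (λ v → g a + (count g r + v)) (count-concat g T) ⟩
  g a + (count g r + (count g (column 0 T) + count g (concat (dropColumn T))))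
    ≡⟨ sym (+-assoc (g a) (count g r) _) ⟩
  g a + count g r + (count g (column 0 T) + count g (concat (dropColumn T)))
    ≡⟨ interchange (g a) (count g r) (count g (column 0 T)) _ ⟩
  g a + count g (column 0 T) + (count g r + count g (concat (dropColumn T)))
    ≡⟨ cong (g a + count g (column 0 T) +_) (sym (count-++ g r _)) ⟩
  g a + count g (column 0 T) + count g (r ++ concat (dropColumn T)) ∎
  where open ≡-Reasoning

length-concat : ∀ (T : Filling n) →
                length (concat T) ≡ length (column 0 T) + length (concat (dropColumn T))
length-concat T = begin
  length (concat T)
    ≡⟨ count-1≡length (concat T) ⟨
  count (λ _ → 1) (concat T)
    ≡⟨ count-concat (λ _ → 1) T ⟩
  count (λ _ → 1) (column 0 T) + count (λ _ → 1) (concat (dropColumn T))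
    ≡⟨ cong₂ _+_ (count-1≡length (column 0 T)) (count-1≡length (concat (dropColumn T))) ⟩
  length (column 0 T) + length (concat (dropColumn T))
    ∎
  where open ≡-Reasoning

shape-dropColumn : ∀ (T : Filling n) → shape (dropColumn T) ≡ map (_∸ 1) (shape T)
shape-dropColumn []      = refl
shape-dropColumn (r ∷ T) = cong₂ _∷_ (length-drop 1 r) (shape-dropColumn T)

IsPartition-dropColumn : ∀ (T : Filling n) → IsPartition (shape T) →
                         IsPartition (shape (dropColumn T))
IsPartition-dropColumn T λ-partition rewrite shape-dropColumn T =
  Linked.map⁺ (Linked.map (∸-monoˡ-≤ 1) λ-partition)

column₀-empty : ∀ (T : Filling n) → IsPartition (0 ∷ shape T) → column 0 T ≡ []
column₀-empty []            _            = refl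
column₀-empty ([] ∷ T)      (_ ∷ linked) = column₀-empty T linked
column₀-empty ((a ∷ r) ∷ T) (() ∷ _)

column₀-take-empty : ∀ k (T : Filling n) → column 0 T ≡ [] → column 0 (take k T) ≡ []
column₀-take-empty zero    T             _ = refl
column₀-take-empty (suc k) []            _ = refl
column₀-take-empty (suc k) ([] ∷ T)      e = column₀-take-empty k T e
column₀-take-empty (suc k) ((a ∷ r) ∷ T) ()

-- In a Young diagram the nonempty rows come first.
length-column₀-take : ∀ k (T : Filling n) → IsPartition (shape T) →
                      length (column 0 (take k T)) ≡ k ⊓ length (column 0 T)
length-column₀-take zero    []            _ = refl
length-column₀-take (suc k) []            _ = refl
length-column₀-take k       ([] ∷ T)      linked
  rewrite column₀-empty T linked | column₀-take-empty k ([] ∷ T) (column₀-empty T linked) =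
  sym (⊓-zeroʳ k)
length-column₀-take zero    ((a ∷ r) ∷ T) _ = refl
length-column₀-take (suc k) ((a ∷ r) ∷ T) linked =
  cong suc (length-column₀-take k T (Linked.tail linked))

sumBelow-part-shape : ∀ k (T : Filling n) → sumBelow k (part (shape T)) ≡ length (concat (take k T))
sumBelow-part-shape zero    []      = refl
sumBelow-part-shape (suc k) []      = sumBelow-zero (suc k)
sumBelow-part-shape zero    (r ∷ T) = refl
sumBelow-part-shape (suc k) (r ∷ T) =
  trans (sumBelow-suc k (part (shape (r ∷ T))))
        (trans (cong (length r +_) (sumBelow-part-shape k T)) (sym (length-++ r)))

rows≤numColumns : ∀ (T : Filling n) → All (λ r → length r ≤ numColumns T) T
rows≤numColumns []      = []
rows≤numColumns (r ∷ T) =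
  m≤m⊔n (length r) _ ∷ All.map (λ r≤ → ≤-trans r≤ (m≤n⊔m (length r) _)) (rows≤numColumns T)

concat-empty : ∀ (T : Filling n) → All (λ r → length r ≤ 0) T → concat T ≡ []
concat-empty []            _        = refl
concat-empty ([] ∷ T)      (_ ∷ T₀) = concat-empty T T₀
concat-empty ((a ∷ r) ∷ T) (() ∷ _)

count≤length-concat-take : ∀ (g : Fin n → ℕ) k m (T : Filling n) → (∀ p → g p ≤ 1) →
                           IsPartition (shape T) → All (λ r → length r ≤ m) T →
                           (∀ j → count g (column j T) ≤ k) →
                           count g (concat T) ≤ length (concat (take k T))
count≤length-concat-take g k zero    T g≤1 _ short _ rewrite concat-empty T short = z≤n
count≤length-concat-take g k (suc m) T g≤1 λ-partition short column≤k = begin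
  count g (concat T)                                               ≡⟨ count-concat g T ⟩
  count g (column 0 T) + count g (concat (dropColumn T))           ≤⟨ +-mono-≤ first rest ⟩
  length (column 0 (take k T)) + length (concat (take k (dropColumn T)))
    ≡⟨ cong (λ U → length (column 0 (take k T)) + length (concat U)) (take-map k T) ⟩
  length (column 0 (take k T)) + length (concat (dropColumn (take k T))) ≡⟨ length-concat (take k T) ⟨
  length (concat (take k T))                                       ∎
  where
    open ≤-Reasoning
    first : count g (column 0 T) ≤ length (column 0 (take k T))
    first rewrite length-column₀-take k T λ-partition =
      ⊓-glb (column≤k 0) (count≤length g≤1 (column 0 T))
    shorter : All (λ r → length r ≤ m) (dropColumn T)
    shorter = All.map⁺ (All.map (λ {r} r≤ → subst (_≤ m) (sym (length-drop 1 r)) (∸-monoˡ-≤ 1 r≤)) short)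
    rest : count g (concat (dropColumn T)) ≤ length (concat (take k (dropColumn T)))
    rest = count≤length-concat-take g k m (dropColumn T) g≤1 (IsPartition-dropColumn T λ-partition)
             shorter (λ j → subst (λ U → count g U ≤ k) (column-suc j T) (column≤k (suc j)))

count≤sumBelow : ∀ (g : Fin n → ℕ) k (T : Filling n) → (∀ p → g p ≤ 1) → IsPartition (shape T) →
                 (∀ j → count g (column j T) ≤ k) → count g (concat T) ≤ sumBelow k (part (shape T))
count≤sumBelow g k T g≤1 λ-partition column≤k rewrite sumBelow-part-shape k T =
  count≤length-concat-take g k (numColumns T) T g≤1 λ-partition (rows≤numColumns T) column≤k

count-below-filling : ∀ k (colour : Fin n → ℕ) (T : Filling n) → IsPartition (shape T) →
                      (∀ j → AllPairs (_≢_ on colour) (column j T)) →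
                      count (below k ∘ colour) (concat T) ≤ sumBelow k (part (shape T))
count-below-filling k colour T λ-partition distinct =
  count≤sumBelow (below k ∘ colour) k T (below≤1 k ∘ colour) λ-partition
    (λ j → count-below-distinct k colour (distinct j))

entry-beyond : ∀ (r : List A) j → length r ≤ j → entry r j ≡ nothing
entry-beyond []      j       _         = refl
entry-beyond (a ∷ r) (suc j) (s≤s r≤j) = entry-beyond r j r≤j

column-beyond : ∀ (T : Filling n) j → numColumns T ≤ j → column j T ≡ []
column-beyond []      j _ = refl
column-beyond (r ∷ T) j T≤j rewrite entry-beyond r j (≤-trans (m≤m⊔n (length r) _) T≤j) =
  column-beyond T j (≤-trans (m≤n⊔m (length r) _) T≤j)

All-columns⁻ : ∀ {P : List (Fin n) → Set} (T : Filling n) → P [] → All P (columns T) →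
               ∀ j → P (column j T)
All-columns⁻ {P = P} T P[] P-columns j with j <? numColumns T
... | yes j<T = All.applyUpTo⁻ id (numColumns T) (All.map⁻ P-columns) j<T
... | no  j≮T = subst P (sym (column-beyond T j (≮⇒≥ j≮T))) P[]

All-columns⁺ : ∀ {p} {P : List (Fin n) → Set p} (T : Filling n) → (∀ j → P (column j T)) →
               All P (columns T)
All-columns⁺ T P-column = All.map⁺ (All.applyUpTo⁺₂ id (numColumns T) P-column)

rows : List ℕ → List A → List (List A)
rows []       xs = []
rows (m ∷ ms) xs = take m xs ∷ rows ms (drop m xs)

sum-drop : ∀ m ms (xs : List A) → m + sum ms ≡ length xs → sum ms ≡ length (drop m xs)
sum-drop m ms xs size =
  trans (sym (m+n∸m≡n m (sum ms))) (trans (cong (_∸ m) size) (sym (length-drop m xs)))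

concat-rows : ∀ ms (xs : List A) → sum ms ≡ length xs → concat (rows ms xs) ≡ xs
concat-rows []       []       _    = refl
concat-rows (m ∷ ms) xs       size =
  trans (cong (take m xs ++_) (concat-rows ms (drop m xs) (sum-drop m ms xs size)))
        (take++drop≡id m xs)

shape-rows : ∀ ms (xs : List A) → sum ms ≡ length xs → map length (rows ms xs) ≡ ms
shape-rows []       xs _    = refl
shape-rows (m ∷ ms) xs size =
  cong₂ _∷_ length-row (shape-rows ms (drop m xs) (sum-drop m ms xs size))
  where
    length-row : length (take m xs) ≡ m
    length-row = trans (length-take m xs) (m≤n⇒m⊓n≡m (subst (m ≤_) size (m≤m+n m (sum ms))))

labelRows : (ℕ → B) → List (List A) → List (List (A × B))
labelRows g []      = []
labelRows g (r ∷ T) = map (_, g 0) r ∷ labelRows (g ∘ suc) T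

keys-labelRows : ∀ (g : ℕ → B) (T : List (List A)) → map proj₁ (concat (labelRows g T)) ≡ concat T
keys-labelRows g []      = refl
keys-labelRows g (r ∷ T) =
  trans (map-++ proj₁ (map (_, g 0) r) _)
        (cong₂ _++_ (trans (sym (map-∘ r)) (map-id r)) (keys-labelRows (g ∘ suc) T))

lookupValue : List (Fin n × ℕ) → Fin n → ℕ
lookupValue []              p = 0
lookupValue ((q , v) ∷ kvs) p with p ≟ᶠ q
... | yes _ = v
... | no  _ = lookupValue kvs p

lookupValue-correct : ∀ (kvs : List (Fin n × ℕ)) → AllPairs (_≢_ on proj₁) kvs →
                      All (λ kv → lookupValue kvs (proj₁ kv) ≡ proj₂ kv) kvs
lookupValue-correct []              []                 = []
lookupValue-correct ((q , v) ∷ kvs) (q-fresh ∷ unique) =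
  atHead ∷ All.zipWith inTail (q-fresh , lookupValue-correct kvs unique)
  where
    atHead : lookupValue ((q , v) ∷ kvs) q ≡ v
    atHead with q ≟ᶠ q
    ... | yes _   = refl
    ... | no  q≢q = ⊥-elim (q≢q refl)
    inTail : ∀ {kv} → q ≢ proj₁ kv × lookupValue kvs (proj₁ kv) ≡ proj₂ kv →
             lookupValue ((q , v) ∷ kvs) (proj₁ kv) ≡ proj₂ kv
    inTail {kv} (q≢p , found) with proj₁ kv ≟ᶠ q
    ... | yes p≡q = ⊥-elim (q≢p (sym p≡q))
    ... | no  _   = found

RowsColoured : (A → B) → (ℕ → B) → List (List A) → Set
RowsColoured c g []      = ⊤
RowsColoured c g (r ∷ T) = All (λ a → c a ≡ g 0) r × RowsColoured c (g ∘ suc) T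

labelRows-coloured : ∀ (c : A → B) g T →
                     All (λ kv → c (proj₁ kv) ≡ proj₂ kv) (concat (labelRows g T)) → RowsColoured c g T
labelRows-coloured c g []      _          = tt
labelRows-coloured c g (r ∷ T) consistent =
  All.map⁻ (All.++⁻ˡ _ consistent) , labelRows-coloured c (g ∘ suc) T (All.++⁻ʳ _ consistent)

RowsColoured-concat : ∀ (Q : B → Set) {c : A → B} {g} T → (∀ i → Q (g i)) → RowsColoured c g T →
                      All (Q ∘ c) (concat T)
RowsColoured-concat Q []      Q-g _         = []
RowsColoured-concat Q (r ∷ T) Q-g (r₀ , T₀) =
  All.++⁺ (All.map (λ ca≡g0 → subst Q (sym ca≡g0) (Q-g 0)) r₀)
          (RowsColoured-concat Q T (Q-g ∘ suc) T₀)

All-entry : ∀ {P : A → Set} (r : List A) j {a} → All P r → entry r j ≡ just a → P a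
All-entry (b ∷ r) zero    (Pb ∷ _)  refl  = Pb
All-entry (b ∷ r) (suc j) (_ ∷ P-r) found = All-entry r j P-r found

RowsColoured-column : ∀ (Q : ℕ → Set) {c : Fin n → ℕ} {g} j (T : Filling n) →
                      (∀ i → Q (g i)) → RowsColoured c g T → All (Q ∘ c) (column j T)
RowsColoured-column Q j []      Q-g _         = []
RowsColoured-column Q j (r ∷ T) Q-g (r₀ , T₀) with entry r j in found
... | just a  =
  subst Q (sym (All-entry r j r₀ found)) (Q-g 0) ∷ RowsColoured-column Q j T (Q-g ∘ suc) T₀
... | nothing = RowsColoured-column Q j T (Q-g ∘ suc) T₀

RowsColoured-distinct : ∀ {c : Fin n → ℕ} {g} → Injective _≡_ _≡_ g → ∀ j (T : Filling n) →
                        RowsColoured c g T → AllPairs (_≢_ on c) (column j T)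
RowsColoured-distinct             g-inj j []      _         = []
RowsColoured-distinct {c = c} {g} g-inj j (r ∷ T) (r₀ , T₀) with entry r j in found
... | just a  =
  RowsColoured-column (c a ≢_) j T (λ i ca≡ → 0≢1+n (g-inj (trans (sym ca≡g0) ca≡))) T₀
  ∷ RowsColoured-distinct (suc-injective ∘ g-inj) j T T₀
  where ca≡g0 = All-entry r j r₀ found
... | nothing = RowsColoured-distinct (suc-injective ∘ g-inj) j T T₀

count-below-coloured : ∀ {c : A → ℕ} {g} t k (T : List (List A)) → RowsColoured c g T →
                       (∀ j → below t (g j) ≡ below k j) →
                       count (below t ∘ c) (concat T) ≡ sumBelow k (part (map length T))
count-below-coloured         t k []      _         _      = sym (sumBelow-zero k)
count-below-coloured {c = c} t k (r ∷ T) (r₀ , T₀) g-below = begin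
  count (below t ∘ c) (r ++ concat T)                       ≡⟨ count-++ (below t ∘ c) r (concat T) ⟩
  count (below t ∘ c) r + count (below t ∘ c) (concat T)
    ≡⟨ cong₂ _+_ (count-constant r (All.map (λ ca≡ → trans (cong (below t) ca≡) (g-below 0)) r₀))
                 (count-below-coloured t (pred k) T T₀ (λ j → trans (g-below (suc j)) (below-pred k j))) ⟩
  length r ℕ.* below k 0 + sumBelow (pred k) (part (map length T))
    ≡⟨ sumBelow-part-∷ k (length r) (map length T) ⟩
  sumBelow k (part (map length (r ∷ T)))                    ∎
  where open ≡-Reasoning

jump : ℕ → ℕ → ℕ → ℕ
jump s t j with j <? s
... | yes _ = j
... | no  _ = t + j

jump-outside : ∀ s t j → jump s t j < s ⊎ t ≤ jump s t j
jump-outside s t j with j <? s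
... | yes j<s = inj₁ j<s
... | no  _   = inj₂ (m≤m+n t j)

jump-below : ∀ {s t} → s ≤ t → ∀ j → below t (jump s t j) ≡ below s j
jump-below {s} {t} s≤t j with j <? s
... | yes j<s = trans (below-< (<-≤-trans j<s s≤t)) (sym (below-< j<s))
... | no  j≮s = trans (below-≥ (m≤m+n t j)) (sym (below-≥ (≮⇒≥ j≮s)))

jump-injective : ∀ {s t} → s ≤ t → Injective _≡_ _≡_ (jump s t)
jump-injective {s} {t} s≤t {i} {j} same with i <? s | j <? s
... | yes _   | yes _   = same
... | yes i<s | no  _   = ⊥-elim (<-irrefl same (<-≤-trans i<s (≤-trans s≤t (m≤m+n t j))))
... | no  _   | yes j<s = ⊥-elim (<-irrefl (sym same) (<-≤-trans j<s (≤-trans s≤t (m≤m+n t i))))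
... | no  _   | no  _   = +-cancelˡ-≡ t i j same

record Admissible {n : ℕ} (s t : ℕ) (colour : Fin n → ℕ) (T S : Filling n) : Set where
  field
    distinctᵀ : ∀ j → AllPairs (_≢_ on colour) (column j T)
    distinctˢ : ∀ j → AllPairs (_≢_ on colour) (column j S)
    outsideˢ  : All (λ p → colour p < s ⊎ t ≤ colour p) (concat S)

canonical : ∀ {n s t} ϑ ω → sum ϑ + sum ω ≡ n → s ≤ t →
            Σ[ T ∈ Filling n ] Σ[ S ∈ Filling n ] Σ[ colour ∈ (Fin n → ℕ) ]
              IsBitableau ϑ ω T S × Admissible s t colour T S ×
              count (below t ∘ colour) (allFin n) ≡ sumBelow t (part ϑ) + sumBelow s (part ω)
canonical {n} {s} {t} ϑ ω size s≤t = T , S , colour , bitableau , admissible , counted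
  where
    X = allFin n
    length-X : length X ≡ sum ϑ + sum ω
    length-X = trans (length-tabulate id) (sym size)
    size-T : sum ϑ ≡ length (take (sum ϑ) X)
    size-T = sym (trans (length-take (sum ϑ) X)
                        (m≤n⇒m⊓n≡m (subst (sum ϑ ≤_) (sym length-X) (m≤m+n _ _))))
    size-S : sum ω ≡ length (drop (sum ϑ) X)
    size-S = sum-drop (sum ϑ) ω X (sym length-X)

    T = rows ϑ (take (sum ϑ) X)
    S = rows ω (drop (sum ϑ) X)
    concat-TS : concat T ++ concat S ≡ X
    concat-TS = trans (cong₂ _++_ (concat-rows ϑ _ size-T) (concat-rows ω _ size-S))
                      (take++drop≡id (sum ϑ) X)

    labelled = concat (labelRows id T) ++ concat (labelRows (jump s t) S)
    keys : map proj₁ labelled ≡ X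
    keys = trans (map-++ proj₁ (concat (labelRows id T)) _)
                 (trans (cong₂ _++_ (keys-labelRows id T) (keys-labelRows (jump s t) S)) concat-TS)
    colour = lookupValue labelled
    consistent =
      lookupValue-correct labelled (AllPairs.map⁻ (subst (AllPairs _≢_) (sym keys) (allFin⁺ n)))
    coloured-T : RowsColoured colour id T
    coloured-T = labelRows-coloured colour id T (All.++⁻ˡ _ consistent)
    coloured-S : RowsColoured colour (jump s t) S
    coloured-S = labelRows-coloured colour (jump s t) S (All.++⁻ʳ _ consistent)

    bitableau : IsBitableau ϑ ω T S
    bitableau = shape-rows ϑ _ size-T , shape-rows ω _ size-S , ↭-reflexive concat-TS

    admissible : Admissible s t colour T S
    admissible = record
      { distinctᵀ = λ j → RowsColoured-distinct (λ same → same) j T coloured-T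
      ; distinctˢ = λ j → RowsColoured-distinct (jump-injective s≤t) j S coloured-S
      ; outsideˢ  = RowsColoured-concat (λ c → c < s ⊎ t ≤ c) S (jump-outside s t) coloured-S
      }

    counted : count (below t ∘ colour) X ≡ sumBelow t (part ϑ) + sumBelow s (part ω)
    counted = begin
      count f X                                           ≡⟨ cong (count f) concat-TS ⟨
      count f (concat T ++ concat S)                      ≡⟨ count-++ f (concat T) (concat S) ⟩
      count f (concat T) + count f (concat S)
        ≡⟨ cong₂ _+_ (count-below-coloured t t T coloured-T (λ _ → refl))
                     (count-below-coloured t s S coloured-S (jump-below s≤t)) ⟩
      sumBelow t (part (shape T)) + sumBelow s (part (shape S))
        ≡⟨ cong₂ (λ a b → sumBelow t (part a) + sumBelow s (part b))
                 (shape-rows ϑ _ size-T) (shape-rows ω _ size-S) ⟩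
      sumBelow t (part ϑ) + sumBelow s (part ω)           ∎
      where
        open ≡-Reasoning
        f = below t ∘ colour

square-injective : ∀ {m o} → m ℕ.* m ≡ o ℕ.* o → m ≡ o
square-injective {m} {o} same with <-cmp m o
... | tri< m<o _ _ = ⊥-elim (<-irrefl same (*-mono-< m<o m<o))
... | tri≈ _ m≡o _ = m≡o
... | tri> _ _ o<m = ⊥-elim (<-irrefl (sym same) (*-mono-< o<m o<m))

outside? : ∀ s t c → Dec (c < s ⊎ t ≤ c)
outside? s t c = c <? s ⊎-dec t ≤? c

value : ℕ → ℕ → ℕ → ℕ
value s t c with outside? s t c
... | yes _ = suc c
... | no  _ = 0

value-outside : ∀ {s t c} → c < s ⊎ t ≤ c → value s t c ≡ suc c
value-outside {s} {t} {c} out with outside? s t c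
... | yes _    = refl
... | no  ¬out = ⊥-elim (¬out out)

-- For t ≤ s + 1 the gap [s, t) contains no colour other than s.
value-injective : ∀ {s t} → t ≤ suc s → Injective _≡_ _≡_ (value s t)
value-injective {s} {t} t≤1+s {c} {d} same with outside? s t c | outside? s t d
... | yes _  | yes _  = suc-injective same
... | yes _  | no  _  = ⊥-elim (0≢1+n (sym same))
... | no  _  | yes _  = ⊥-elim (0≢1+n same)
... | no  c∈ | no  d∈ = trans (in-gap c∈) (sym (in-gap d∈))
  where
    in-gap : ∀ {a} → ¬ (a < s ⊎ t ≤ a) → a ≡ s
    in-gap a∈ = ≤-antisym (≤-pred (≤-trans (≰⇒> (a∈ ∘ inj₂)) t≤1+s)) (≮⇒≥ (a∈ ∘ inj₁))

module _ {c ℓ : Level} (K : CommutativeRing c ℓ) where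
  open CommutativeRing K
    using (Carrier; _≈_; _*_; _-_; 0#; 1#; semiring; +-group; *-congˡ; *-congʳ; zeroˡ; zeroʳ)
    renaming (refl to ≈-refl; reflexive to ≈-reflexive; trans to ≈-trans)
  open GroupProperties +-group using (x≈y⇒x∙y⁻¹≈ε)
  open SemiringMultiplication semiring using () renaming (_×_ to _·_)

  ι : ℕ → Carrier
  ι m = m · 1#

  point : ℕ → ℕ → (Fin n → ℕ) → Fin n → Carrier
  point s t colour p = ι (value s t (colour p))

  *-zero-or : ∀ {a b} {P Q : Set} → a ≈ 0# ⊎ P → b ≈ 0# ⊎ Q → a * b ≈ 0# ⊎ P × Q
  *-zero-or (inj₁ a≈0) _          = inj₁ (≈-trans (*-congʳ a≈0) (zeroˡ _))
  *-zero-or (inj₂ _)   (inj₁ b≈0) = inj₁ (≈-trans (*-congˡ b≈0) (zeroʳ _))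
  *-zero-or (inj₂ p)   (inj₂ q)   = inj₂ (p , q)

  prod-zero-or-All : ∀ {P : A → Set} (f : A → Carrier) → (∀ a → f a ≈ 0# ⊎ P a) →
                     ∀ xs → prod K (map f xs) ≈ 0# ⊎ All P xs
  prod-zero-or-All f zero-or []       = inj₂ []
  prod-zero-or-All f zero-or (a ∷ xs) =
    Sum.map₂ (uncurry _∷_) (*-zero-or (zero-or a) (prod-zero-or-All f zero-or xs))

  Δ-zero-or-distinct : ∀ (f : ℕ → Carrier) (colour : Fin n → ℕ) xs →
                       Δ K (f ∘ colour) xs ≈ 0# ⊎ AllPairs (_≢_ on colour) xs
  Δ-zero-or-distinct f colour []       = inj₂ []
  Δ-zero-or-distinct f colour (a ∷ xs) =
    Sum.map₂ (uncurry _∷_) (*-zero-or (prod-zero-or-All _ differ xs) (Δ-zero-or-distinct f colour xs))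
    where
      differ : ∀ b → f (colour a) - f (colour b) ≈ 0# ⊎ colour a ≢ colour b
      differ b with colour a ≟ colour b
      ... | yes same = inj₁ (x≈y⇒x∙y⁻¹≈ε (≈-reflexive (cong f same)))
      ... | no  diff = inj₂ diff

  point-zero-or-outside : ∀ s t (colour : Fin n → ℕ) p →
                          point s t colour p ≈ 0# ⊎ (colour p < s ⊎ t ≤ colour p)
  point-zero-or-outside s t colour p with outside? s t (colour p)
  ... | yes out = inj₂ out
  ... | no  _   = inj₁ ≈-refl

  specht-zero-or-admissible : ∀ s t (colour : Fin n → ℕ) T S →
                              specht K T S (point s t colour) ≈ 0# ⊎ Admissible s t colour T S
  specht-zero-or-admissible s t colour T S =
    Sum.map₂ admissible
      (*-zero-or (*-zero-or (columns-zero-or T) (columns-zero-or S))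
                 (prod-zero-or-All _ (point-zero-or-outside s t colour) (concat S)))
    where
      square = λ c → ι (value s t c) * ι (value s t c)
      columns-zero-or : ∀ U → prod K (map (Δ K (square ∘ colour)) (columns U)) ≈ 0#
                              ⊎ All (AllPairs (_≢_ on colour)) (columns U)
      columns-zero-or U = prod-zero-or-All _ (Δ-zero-or-distinct square colour) (columns U)
      admissible : _ → Admissible s t colour T S
      admissible ((distinct-T , distinct-S) , outside) = record
        { distinctᵀ = All-columns⁻ T [] distinct-T
        ; distinctˢ = All-columns⁻ S [] distinct-S
        ; outsideˢ  = outside
        }

count-below-bitableau : ∀ {s t λ' μ} {colour : Fin n → ℕ} {T S} → s ≤ t →
                        IsPartition λ' → IsPartition μ → IsBitableau λ' μ T S → Admissible s t colour T S →
                        count (below t ∘ colour) (allFin n) ≤ sumBelow t (part λ') + sumBelow s (part μ)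
count-below-bitableau {n} {s} {t} {colour = colour} {T} {S}
                      s≤t λ-partition μ-partition (refl , refl , perm) admissible = begin
  count f (allFin n)                                         ≡⟨ count-↭ f perm ⟨
  count f (concat T ++ concat S)                             ≡⟨ count-++ f (concat T) (concat S) ⟩
  count f (concat T) + count f (concat S)
    ≡⟨ cong (count f (concat T) +_) (count-cong (All.map (below-outside s≤t) outsideˢ)) ⟩
  count f (concat T) + count (below s ∘ colour) (concat S)
    ≤⟨ +-mono-≤ (count-below-filling t colour T λ-partition distinctᵀ)
                (count-below-filling s colour S μ-partition distinctˢ) ⟩
  sumBelow t (part (shape T)) + sumBelow s (part (shape S)) ∎
  where
    open ≤-Reasoning
    open Admissible admissible
    f = below t ∘ colour

module _ {c ℓ : Level} (K : CommutativeRing c ℓ) (isField : IsField K) (charZero : CharZero K) where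
  open CommutativeRing K
    using (Carrier; _≈_; _*_; _-_; 0#; 1#; semiring; +-group;
           *-congˡ; *-congʳ; *-comm; *-assoc; *-identityˡ; zeroʳ)
    renaming (_+_ to _+ᴷ_; sym to ≈-sym; trans to ≈-trans; reflexive to ≈-reflexive)
  open IsField isField
  open GroupProperties +-group using (x∙y⁻¹≈ε⇒x≈y; identityʳ-unique)
  open SemiringMultiplication semiring using (×-homo-+; ×1-homo-*)
  open import Relation.Binary.Reasoning.Setoid (CommutativeRing.setoid K)

  *-nonzero : ∀ {a b} → ¬ a ≈ 0# → ¬ b ≈ 0# → ¬ a * b ≈ 0#
  *-nonzero {a} {b} a≉0 b≉0 ab≈0 with inverse a a≉0
  ... | a⁻¹ , aa⁻¹≈1 = b≉0 (begin
    b               ≈⟨ *-identityˡ b ⟨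
    1# * b          ≈⟨ *-congʳ aa⁻¹≈1 ⟨
    a * a⁻¹ * b     ≈⟨ *-congʳ (*-comm a a⁻¹) ⟩
    a⁻¹ * a * b     ≈⟨ *-assoc a⁻¹ a b ⟩
    a⁻¹ * (a * b)   ≈⟨ *-congˡ ab≈0 ⟩
    a⁻¹ * 0#        ≈⟨ zeroʳ a⁻¹ ⟩
    0#              ∎)

  prod-nonzero : ∀ (f : A → Carrier) {xs} → All (λ a → ¬ f a ≈ 0#) xs →
                 ¬ prod K (map f xs) ≈ 0#
  prod-nonzero f []           = 1≉0
  prod-nonzero f (fa≉0 ∷ f≉0) = *-nonzero fa≉0 (prod-nonzero f f≉0)

  Δ-nonzero : ∀ (y : Fin n → Carrier) {xs} → AllPairs (λ a b → ¬ y a - y b ≈ 0#) xs →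
              ¬ Δ K y xs ≈ 0#
  Δ-nonzero y []                = 1≉0
  Δ-nonzero y (a-apart ∷ apart) = *-nonzero (prod-nonzero _ a-apart) (Δ-nonzero y apart)

  ι-<-distinct : ∀ {m o} → m < o → ¬ ι K m ≈ ι K o
  ι-<-distinct {m} m<o ιm≈ιo with m≤n⇒∃[o]m+o≡n m<o
  ... | d , refl = charZero d (identityʳ-unique (ι K m) (ι K (suc d)) (begin
    ι K m +ᴷ ι K (suc d)  ≈⟨ ×-homo-+ 1# m (suc d) ⟨
    ι K (m + suc d)       ≡⟨ cong (ι K) (+-suc m d) ⟩
    ι K (suc m + d)       ≈⟨ ιm≈ιo ⟨
    ι K m                 ∎))

  ι-injective : ∀ {m o} → ι K m ≈ ι K o → m ≡ o
  ι-injective {m} {o} ιm≈ιo with <-cmp m o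
  ... | tri< m<o _ _ = ⊥-elim (ι-<-distinct m<o ιm≈ιo)
  ... | tri≈ _ m≡o _ = m≡o
  ... | tri> _ _ o<m = ⊥-elim (ι-<-distinct o<m (≈-sym ιm≈ιo))

  ι-square-injective : ∀ {m o} → ι K m * ι K m ≈ ι K o * ι K o → m ≡ o
  ι-square-injective {m} {o} same =
    square-injective (ι-injective (≈-trans (×1-homo-* m m) (≈-trans same (≈-sym (×1-homo-* o o)))))

  specht-nonzero : ∀ {s t} {colour : Fin n → ℕ} {T S} → t ≤ suc s → Admissible s t colour T S →
                   ¬ specht K T S (point K s t colour) ≈ 0#
  specht-nonzero {n} {s} {t} {colour} {T} {S} gap admissible =
    *-nonzero (*-nonzero (columns-nonzero T distinctᵀ) (columns-nonzero S distinctˢ))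
              (prod-nonzero _ (All.map cell-nonzero outsideˢ))
    where
      open Admissible admissible
      x = point K s t colour
      squares-apart : ∀ {a b} → colour a ≢ colour b → ¬ x a * x a - x b * x b ≈ 0#
      squares-apart colours≢ difference≈0 =
        colours≢ (value-injective gap (ι-square-injective (x∙y⁻¹≈ε⇒x≈y _ _ difference≈0)))
      columns-nonzero : ∀ U → (∀ j → AllPairs (_≢_ on colour) (column j U)) →
                        ¬ prod K (map (Δ K (λ p → x p * x p)) (columns U)) ≈ 0#
      columns-nonzero U distinct =
        prod-nonzero _ (All-columns⁺ U (λ j → Δ-nonzero _ (AllPairs.map squares-apart (distinct j))))
      cell-nonzero : ∀ {p} → colour p < s ⊎ t ≤ colour p → ¬ x p ≈ 0#
      cell-nonzero {p} out =
        charZero (colour p) ∘ ≈-trans (≈-reflexive (cong (ι K) (sym (value-outside out))))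

  inclusion⇒sumBelow≤ : ∀ {n λ' μ ϑ ω} → InBP n λ' μ → InBP n ϑ ω →
                        (∀ x → InV K n λ' μ x → InV K n ϑ ω x) →
                        ∀ {s t} → s ≤ t → t ≤ suc s →
                        sumBelow t (part ϑ) + sumBelow s (part ω) ≤ sumBelow t (part λ') + sumBelow s (part μ)
  inclusion⇒sumBelow≤ {n} {λ'} {μ} {ϑ} {ω} (λ-partition , μ-partition , _) (_ , _ , size) V⊆V {s} {t} s≤t gap
    with canonical ϑ ω size s≤t
  ... | T , S , colour , bitableau , admissible , counted
    with sumBelow t (part ϑ) + sumBelow s (part ω) ≤? sumBelow t (part λ') + sumBelow s (part μ)
  ... | yes ≤ = ≤
  ... | no  ≰ = ⊥-elim (specht-nonzero gap admissible (V⊆V x x∈V T S bitableau))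
    where
      x = point K s t colour
      x∈V : InV K n λ' μ x
      x∈V T′ S′ bitableau′ with specht-zero-or-admissible K s t colour T′ S′
      ... | inj₁ vanishes    = vanishes
      ... | inj₂ admissible′ = ⊥-elim (≰ (subst (_≤ _) counted
              (count-below-bitableau s≤t λ-partition μ-partition bitableau′ admissible′)))

proposition3 : ∀ {c ℓ : Level} (K : CommutativeRing c ℓ) → IsField K → CharZero K →
    (n : ℕ) (λ' μ ϑ ω : List ℕ) → InBP n λ' μ → InBP n ϑ ω →
    (∀ (x : Fin n → CommutativeRing.Carrier K) → InV K n λ' μ x → InV K n ϑ ω x) →
    (ϑ , ω) ⊴ (λ' , μ)
proposition3 K isField charZero n λ' μ ϑ ω λμ∈BP ϑω∈BP V⊆V i =
  subst₂ _≤_ (sym (sumBelow-+ (suc i) (part ϑ) (part ω))) (sym (sumBelow-+ (suc i) (part λ') (part μ)))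
    (partialSums {suc i} {suc i} ≤-refl (n≤1+n (suc i))) ,
  subst₂ _≤_ (split ϑ ω) (split λ' μ) (partialSums {i} {suc i} (n≤1+n i) ≤-refl)
  where
    partialSums = inclusion⇒sumBelow≤ K isField charZero λμ∈BP ϑω∈BP V⊆V
    split : ∀ a b → sumBelow (suc i) (part a) + sumBelow i (part b)
                    ≡ sumBelow i (λ j → part a j + part b j) + part a i
    split a b = begin
      sumBelow i (part a) + part a i + sumBelow i (part b)
        ≡⟨ xy∙z≈xz∙y (sumBelow i (part a)) (part a i) (sumBelow i (part b)) ⟩
      sumBelow i (part a) + sumBelow i (part b) + part a i
        ≡⟨ cong (_+ part a i) (sumBelow-+ i (part a) (part b)) ⟨
      sumBelow i (λ j → part a j + part b j) + part a i
        ∎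
      where open ≡-Reasoning
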